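{- Let $n\ge 1$, let $t=(t_1,\dots,t_n)$ be a tuple of nonnegative integers and let $T_1,\dots,T_n$ be pairwise disjoint sets with $|T_i|=t_i$. Define $g_i(t)$ for $1\le i\le n$ as follows: if $t_1>0$, fix $a\in T_1$ and let $g_i(t)$ be the number of generalized derangements $\sigma$ of $\bigcup_j T_j$ with $\sigma(a)\in T_i$; if $t_1=0$, let $g_1(t)=P(t)$ (in particular $g_1(0,\dots,0)=1$) and $g_i(t)=0$ for $i>1$. Write $e_i$ for the $i$-th standard unit vector. Then: (a) if $t_1>0$, then $g_1(t)=0$, and $g_i(t)=0$ for every $i$ with $t_i=0$; (b) if $t_1>0$, $i>1$ and $t_i>0$, then $$g_i(t)=t_i\bigl(t_1P(t-e_1-e_i)+P(t-e_i)-g_i(t-e_i)\bigr);$$ (c) $P(t_1,\dots,t_n)=\sum_{i=1}^n g_i(t_1,\dots,t_n)$.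
   Context: For pairwise disjoint finite sets $T_1,\dots,T_n$ with $|T_i|=t_i$, a generalized derangement (GD) is a permutation $\sigma$ of $\bigcup_{i=1}^n T_i$ such that $\sigma(a)\notin T_i$ for every $i$ and every $a\in T_i$. $P(t_1,\dots,t_n)$ denotes the number of GDs; it depends only on the sizes $t_i$ and is invariant under permuting the arguments, and $P(0,\dots,0)=1$. The value $g_i(t)$ for $t_1>0$ does not depend on the choice of $a\in T_1$. -}

module Defs where

open import Data.Nat using (ℕ; zero; suc; _+_)
open import Data.Fin using (Fin; zero; suc; splitAt; _≟_)
open import Data.Fin.Properties using (all?)
open import Data.Sum using ([_,_]′)
open import Data.Vec using (Vec; []; _∷_; lookup; sum)
open import Data.List using (List; []; _∷_; [_]; map; concatMap; filter; length)
open import Data.List.Base using (allFin)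
open import Relation.Binary.PropositionalEquality using (_≡_; _≢_)
open import Relation.Nullary using (Dec; ¬?)
open import Relation.Nullary.Decidable using (_→-dec_; _×-dec_)
open import Data.Product using (_×_)

-- Model of the ground set ⋃ T_i for a size vector t = (t_1,…,t_n):
-- the elements are Fin (sum t); the first t_1 of them form T_1 (block index
-- zero), the next t_2 form T_2 (block index 1), etc.
block : ∀ {n} (t : Vec ℕ n) → Fin (sum t) → Fin n
block (k ∷ ts) x = [ (λ _ → zero) , (λ y → suc (block ts y)) ]′ (splitAt k x)

allMaps : (k m : ℕ) → List (Vec (Fin m) k)
allMaps zero    m = [ [] ]
allMaps (suc k) m = concatMap (λ x → map (x ∷_) (allMaps k m)) (allFin m)

-- σ (given by its vector of images) is a permutation: injective self-map of a finite set.
IsPerm : ∀ {N} → Vec (Fin N) N → Set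
IsPerm σ = ∀ x y → lookup σ x ≡ lookup σ y → x ≡ y

IsGD : ∀ {n} (t : Vec ℕ n) → Vec (Fin (sum t)) (sum t) → Set
IsGD t σ = IsPerm σ × (∀ a → block t (lookup σ a) ≢ block t a)

isPerm? : ∀ {N} (σ : Vec (Fin N) N) → Dec (IsPerm σ)
isPerm? σ = all? (λ x → all? (λ y → (lookup σ x ≟ lookup σ y) →-dec (x ≟ y)))

isGD? : ∀ {n} (t : Vec ℕ n) (σ : Vec (Fin (sum t)) (sum t)) → Dec (IsGD t σ)
isGD? t σ = isPerm? σ ×-dec all? (λ a → ¬? (block t (lookup σ a) ≟ block t a))

P : ∀ {n} → Vec ℕ n → ℕ
P t = length (filter (isGD? t) (allMaps (sum t) (sum t)))

-- g_i(t), i : Fin (suc n) with index zero ↔ i = 1.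
-- If t_1 > 0 the fixed element a ∈ T_1 is the first element (index zero) of T_1.
g : ∀ {n} → Fin (suc n) → Vec ℕ (suc n) → ℕ
g zero    (zero ∷ ts) = P (zero ∷ ts)
g (suc i) (zero ∷ ts) = 0
g {n} i (suc k ∷ ts) =
  length (filter (λ σ → isGD? t σ ×-dec (block t (lookup σ zero) ≟ i))
                 (allMaps (sum t) (sum t)))
  where t = suc k ∷ ts

module Submission where

-- We count "constrained permutations": a Boolean constraint F on Fin N forbids
-- some steps x ↦ y and # F is the number of permutations avoiding them, with
-- cardinalities compared through explicit bijections with Fin.  Next, for colourings of Fin N the
-- counts P and g_i depend only on the class sizes (#same-relabel,
-- #into-relabel), and g_i is the sum, over the images d of colour i, of the
-- number fixedImage d of generalized derangements with a ↦ d; this gives (a)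
-- and (c).  For (b), contracting a ↦ d leaves class sizes t - e_i with d's old
-- position of colour 1, and splitting by whether that point enters colour i
-- shows fixedImage d + g_i(t - e_i) = t₁ P(t - e₁ - e_i) + P(t - e_i)
-- (#avoid+#into), so each of the t_i images of colour i contributes equally.

open import Defs
open import Data.Nat using (ℕ; zero; suc; _+_; _*_; _∸_; _>_)
open import Data.Fin using (Fin; zero; suc)
open import Data.Vec using (Vec; lookup; tabulate; sum; _[_]%=_)
open import Data.Product using (_×_)
open import Relation.Binary.PropositionalEquality using (_≡_)

open import Data.Bool using (Bool; true; false; T; not; _∧_; _∨_; if_then_else_)
open import Data.Bool.Properties using (T-irrelevant; ∨-zeroʳ; ∨-identityʳ)
open import Data.Empty using (⊥-elim)
open import Data.Fin using (punchIn; punchOut; _↑ˡ_; _↑ʳ_; _≟_)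
import Data.Fin.Properties as FP
open import Data.Fin.Permutation using (↔⇒≡)
import Data.Fin.Permutation.Components as PC
open import Data.List using (List; length; filter; map; concatMap)
import Data.List as L
open import Data.List.Properties using (filter-≐; filter-++; length-++)
import Data.Nat.Properties as NP
open import Data.Product using (Σ; _,_; proj₁; proj₂)
open import Data.Product.Function.Dependent.Propositional using (Σ-↔)
open import Data.Sum using (_⊎_; inj₁; inj₂)
open import Data.Sum.Function.Propositional using (_⊎-↔_)
import Data.Vec as V
import Data.Vec.Properties as VP
open import Function using (_∘_; id)
open import Function.Bundles using (Inverse; _↔_; mk↔ₛ′)
open import Function.Properties.Inverse using (↔-refl; ↔-sym; ↔-trans)
open import Relation.Binary.PropositionalEquality
  using (_≢_; refl; sym; trans; cong; cong₂; subst; module ≡-Reasoning)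
open import Relation.Nullary using (Dec; yes; no; does)
open import Relation.Nullary.Decidable using (True; toWitness; fromWitness; T?; _×-dec_)
open import Relation.Unary using (Decidable)
open import Algebra.Properties.Semiring.Sum NP.+-*-semiring
  using ( sum-syntax; sum-cong-≗; ∑-distrib-+; ∑-comm; ∑-permute; sum-remove
        ; *-distribʳ-sum; sum-replicate-zero)
  renaming (sum to ∑)

open Inverse using (to; from; strictlyInverseˡ; strictlyInverseʳ)

χ : ∀ {P : Set} → Dec P → ℕ
χ d = if does d then 1 else 0

sum-tabulate : ∀ N (f : Fin N → ℕ) → sum (tabulate f) ≡ ∑[ x < N ] f x
sum-tabulate zero    f = refl
sum-tabulate (suc N) f = cong (f zero +_) (sum-tabulate N (f ∘ suc))

∑≡0⇒≡0 : ∀ N (f : Fin N → ℕ) → ∑[ x < N ] f x ≡ 0 → ∀ x → f x ≡ 0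
∑≡0⇒≡0 (suc N) f e zero    = NP.m+n≡0⇒m≡0 (f zero) e
∑≡0⇒≡0 (suc N) f e (suc x) = ∑≡0⇒≡0 N (f ∘ suc) (NP.m+n≡0⇒n≡0 (f zero) e) x

∑-vanishes : ∀ N (f : Fin N → ℕ) → (∀ x → f x ≡ 0) → ∑[ x < N ] f x ≡ 0
∑-vanishes N f f≡0 = trans (sum-cong-≗ f≡0) (sum-replicate-zero N)

∑-δ : ∀ m (u : Fin m) v → ∑[ i < m ] (χ (u ≟ i) * v) ≡ v
∑-δ (suc m) zero    v = begin
  v + 0 + ∑[ i < m ] 0 ≡⟨ cong (v + 0 +_) (sum-replicate-zero m) ⟩
  v + 0 + 0            ≡⟨ NP.+-identityʳ (v + 0) ⟩
  v + 0                ≡⟨ NP.+-identityʳ v ⟩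
  v                    ∎
  where open ≡-Reasoning
∑-δ (suc m) (suc u) v = ∑-δ m u v

∑-split : ∀ k M (f : Fin (k + M) → ℕ) →
  ∑[ x < k + M ] f x ≡ ∑[ x < k ] f (x ↑ˡ M) + ∑[ y < M ] f (k ↑ʳ y)
∑-split zero    M f = refl
∑-split (suc k) M f =
  trans (cong (f zero +_) (∑-split k M (f ∘ suc))) (sym (NP.+-assoc (f zero) _ _))

∑-ones : ∀ k → ∑[ x < k ] 1 ≡ k
∑-ones zero    = refl
∑-ones (suc k) = cong suc (∑-ones k)

size-unique : ∀ {A : Set} {a b} → A ↔ Fin a → A ↔ Fin b → a ≡ b
size-unique i j = ↔⇒≡ (↔-trans (↔-sym i) j)

Σ-Fin-↔ : ∀ m (c : Fin m → ℕ) → Σ (Fin m) (Fin ∘ c) ↔ Fin (∑[ x < m ] c x)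
Σ-Fin-↔ zero    c = mk↔ₛ′ (λ { (() , _) }) (λ ()) (λ ()) (λ { (() , _) })
Σ-Fin-↔ (suc m) c =
  ↔-trans splitZero (↔-trans (↔-refl ⊎-↔ Σ-Fin-↔ m (c ∘ suc)) (↔-sym FP.+↔⊎))
  where
  splitZero : Σ (Fin (suc m)) (Fin ∘ c) ↔ (Fin (c zero) ⊎ Σ (Fin m) (Fin ∘ c ∘ suc))
  splitZero = mk↔ₛ′ (λ { (zero , b) → inj₁ b ; (suc x , b) → inj₂ (x , b) })
                    (λ { (inj₁ b) → zero , b ; (inj₂ (x , b)) → suc x , b })
                    (λ { (inj₁ b) → refl ; (inj₂ (x , b)) → refl })
                    (λ { (zero , b) → refl ; (suc x , b) → refl })

Σ-sizes-↔ : ∀ m {B : Fin m → Set} (c : Fin m → ℕ) → (∀ x → B x ↔ Fin (c x)) →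
  Σ (Fin m) B ↔ Fin (∑[ x < m ] c x)
Σ-sizes-↔ m c e = ↔-trans (Σ-↔ ↔-refl (e _)) (Σ-Fin-↔ m c)

Sat : {A : Set} {P : A → Set} → Decidable P → Set
Sat {A} P? = Σ A (λ x → True (P? x))

Sat-≡ : ∀ {A : Set} {P : A → Set} (P? : Decidable P) {x y : A} → x ≡ y →
  {p : True (P? x)} {q : True (P? y)} → _≡_ {A = Sat P?} (x , p) (y , q)
Sat-≡ P? refl = cong (_ ,_) (T-irrelevant _ _)

Sat-↔ : ∀ {A B : Set} {P : A → Set} {Q : B → Set} (P? : Decidable P) (Q? : Decidable Q)
  (f : A → B) (g : B → A) → (∀ x → P x → Q (f x)) → (∀ y → Q y → P (g y)) →
  (∀ y → Q y → f (g y) ≡ y) → (∀ x → P x → g (f x) ≡ x) → Sat P? ↔ Sat Q?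
Sat-↔ P? Q? f g pq qp fg gf =
  mk↔ₛ′ (λ { (x , p) → f x , fromWitness (pq x (toWitness p)) })
        (λ { (y , q) → g y , fromWitness (qp y (toWitness q)) })
        (λ { (y , q) → Sat-≡ Q? (fg y (toWitness q)) })
        (λ { (x , p) → Sat-≡ P? (gf x (toWitness p)) })

True-↔ : ∀ {P : Set} (d : Dec P) → True d ↔ Fin (χ d)
True-↔ (yes p) = mk↔ₛ′ (λ _ → zero) (λ _ → _) (λ { zero → refl }) (λ _ → refl)
True-↔ (no ¬p) = mk↔ₛ′ (λ ()) (λ ()) (λ ()) (λ ())

count : ∀ k m {P : Vec (Fin m) k → Set} → Decidable P → ℕ
count k m P? = length (filter P? (allMaps k m))

length-filter-map : ∀ {A B : Set} {P : B → Set} (P? : Decidable P) (f : A → B) (xs : List A) →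
  length (filter P? (map f xs)) ≡ length (filter (P? ∘ f) xs)
length-filter-map P? f L.[] = refl
length-filter-map P? f (x L.∷ xs) with does (P? (f x))
... | true  = cong suc (length-filter-map P? f xs)
... | false = length-filter-map P? f xs

length-filter-concatMap : ∀ {A B : Set} {P : B → Set} (P? : Decidable P) m
  (f : Fin m → A) (h : A → List B) →
  length (filter P? (concatMap h (L.tabulate f))) ≡ ∑[ x < m ] length (filter P? (h (f x)))
length-filter-concatMap P? zero    f h = refl
length-filter-concatMap P? (suc m) f h = begin
  length (filter P? (h (f zero) L.++ rest))
    ≡⟨ cong length (filter-++ P? (h (f zero)) rest) ⟩
  length (filter P? (h (f zero)) L.++ filter P? rest)
    ≡⟨ length-++ (filter P? (h (f zero))) ⟩
  length (filter P? (h (f zero))) + length (filter P? rest)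
    ≡⟨ cong (length (filter P? (h (f zero))) +_) (length-filter-concatMap P? m (f ∘ suc) h) ⟩
  _ ∎
  where
  open ≡-Reasoning
  rest = concatMap h (L.tabulate (f ∘ suc))

count-suc : ∀ k m {P : Vec (Fin m) (suc k) → Set} (P? : Decidable P) →
  count (suc k) m P? ≡ ∑[ x < m ] count k m (λ v → P? (x V.∷ v))
count-suc k m P? =
  trans (length-filter-concatMap P? m id (λ x → map (x V.∷_) (allMaps k m)))
        (sum-cong-≗ (λ x → length-filter-map P? (x V.∷_) (allMaps k m)))

count-↔ : ∀ k m {P : Vec (Fin m) k → Set} (P? : Decidable P) → Sat P? ↔ Fin (count k m P?)
count-↔ zero m P? = ↔-trans emptyVec (subst (λ c → True (P? V.[]) ↔ Fin c) countEmpty (True-↔ (P? V.[])))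
  where
  emptyVec : Sat P? ↔ True (P? V.[])
  emptyVec = mk↔ₛ′ (λ { (V.[] , p) → p }) (λ p → V.[] , p) (λ _ → refl) (λ { (V.[] , p) → refl })
  countEmpty : χ (P? V.[]) ≡ count 0 m P?
  countEmpty with P? V.[]
  ... | yes _ = refl
  ... | no _  = refl
count-↔ (suc k) m P? =
  subst (λ c → Sat P? ↔ Fin c) (sym (count-suc k m P?))
    (↔-trans headTail (Σ-sizes-↔ m _ (λ x → count-↔ k m (λ v → P? (x V.∷ v)))))
  where
  headTail : Sat P? ↔ Σ (Fin m) (λ x → Sat (λ v → P? (x V.∷ v)))
  headTail = mk↔ₛ′ (λ { (x V.∷ v , p) → x , v , p }) (λ { (x , v , p) → x V.∷ v , p })
                   (λ { (x , v , p) → refl }) (λ { (x V.∷ v , p) → refl })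

to-injective : ∀ {A B : Set} (ρ : A ↔ B) {x y : A} → to ρ x ≡ to ρ y → x ≡ y
to-injective ρ {x} {y} e =
  trans (sym (strictlyInverseʳ ρ x)) (trans (cong (from ρ) e) (strictlyInverseʳ ρ y))

from-injective : ∀ {A B : Set} (ρ : A ↔ B) {x y : B} → from ρ x ≡ from ρ y → x ≡ y
from-injective ρ = to-injective (↔-sym ρ)

vec-ext : ∀ {A : Set} {n} {u v : Vec A n} → (∀ i → lookup u i ≡ lookup v i) → u ≡ v
vec-ext {u = u} {v} e =
  trans (sym (VP.tabulate∘lookup u)) (trans (VP.tabulate-cong e) (VP.tabulate∘lookup v))

_==_ : ∀ {N} → Fin N → Fin N → Bool
x == y = does (x ≟ y)

==-refl : ∀ {N} (x : Fin N) → (x == x) ≡ true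
==-refl x with x ≟ x
... | yes _  = refl
... | no x≢x = ⊥-elim (x≢x refl)

==-true : ∀ {N} {x y : Fin N} → x ≡ y → (x == y) ≡ true
==-true {x = x} refl = ==-refl x

==-false : ∀ {N} {x y : Fin N} → x ≢ y → (x == y) ≡ false
==-false {x = x} {y} x≢y with x ≟ y
... | yes x≡y = ⊥-elim (x≢y x≡y)
... | no _    = refl

==-sound : ∀ {N} {x y : Fin N} → (x == y) ≡ true → x ≡ y
==-sound {x = x} {y} e with x ≟ y
... | yes x≡y = x≡y
==-sound () | no _

==-cong : ∀ {N M} {x y : Fin N} {x' y' : Fin M} →
  (x ≡ y → x' ≡ y') → (x' ≡ y' → x ≡ y) → (x == y) ≡ (x' == y')
==-cong {x = x} {y} {x'} {y'} f g with x ≟ y | x' ≟ y'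
... | yes p | yes q = refl
... | yes p | no q  = ⊥-elim (q (f p))
... | no p  | yes q = ⊥-elim (p (g q))
... | no p  | no q  = refl

avoid-∨⁻ : ∀ b c → T (not (b ∨ c)) → T (not b) × T (not c)
avoid-∨⁻ false c p = _ , p

avoid-∨⁺ : ∀ b c → T (not b) → T (not c) → T (not (b ∨ c))
avoid-∨⁺ false c _ q = q

T-not-not : ∀ b → T (not (not b)) → b ≡ true
T-not-not true _ = refl

transpose-i : ∀ {n} (i j : Fin n) → PC.transpose i j i ≡ j
transpose-i i j rewrite ==-refl i = refl

transpose-j : ∀ {n} (i j : Fin n) → PC.transpose i j j ≡ i
transpose-j i j with j ≟ i
... | yes j≡i = j≡i
... | no _ rewrite ==-refl j = refl

transpose-other : ∀ {n} {i j k : Fin n} → k ≢ i → k ≢ j → PC.transpose i j k ≡ k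
transpose-other k≢i k≢j rewrite ==-false k≢i | ==-false k≢j = refl

transpose-↔ : ∀ {n} (i j : Fin n) → Fin n ↔ Fin n
transpose-↔ i j = mk↔ₛ′ (PC.transpose i j) (PC.transpose j i)
  (λ _ → PC.transpose-inverse i j) (λ _ → PC.transpose-inverse j i)

transpose-colour : ∀ {N m} (col : Fin N → Fin m) (a d y : Fin N) → col a ≡ col d →
  col (PC.transpose a d y) ≡ col y
transpose-colour col a d y e = byCases (y ≟ a) (y ≟ d)
  where
  byCases : Dec (y ≡ a) → Dec (y ≡ d) → col (PC.transpose a d y) ≡ col y
  byCases (yes refl) _          = trans (cong col (transpose-i y d)) (sym e)
  byCases (no _)     (yes refl) = trans (cong col (transpose-j a y)) e
  byCases (no y≢a)   (no y≢d)   = cong col (transpose-other y≢a y≢d)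

-- A constraint on Fin N: F x y ≡ true forbids a permutation to send x to y.
Constraint : ℕ → Set
Constraint N = Fin N → Fin N → Bool

Respects : ∀ {N} → Constraint N → Vec (Fin N) N → Set
Respects F σ = IsPerm σ × (∀ x → T (not (F x (lookup σ x))))

respects? : ∀ {N} (F : Constraint N) → Decidable (Respects F)
respects? F σ = isPerm? σ ×-dec FP.all? (λ x → T? (not (F x (lookup σ x))))

Solutions : ∀ {N} → Constraint N → Set
Solutions F = Sat (respects? F)

#_ : ∀ {N} → Constraint N → ℕ
#_ {N} F = count N N (respects? F)

#-↔ : ∀ {N} (F : Constraint N) → Solutions F ↔ Fin (# F)
#-↔ {N} F = count-↔ N N (respects? F)

#-cong-↔ : ∀ {N M} (F : Constraint N) (G : Constraint M) → Solutions F ↔ Solutions G → # F ≡ # G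
#-cong-↔ F G e = size-unique (#-↔ F) (↔-trans e (#-↔ G))

conj : ∀ {N M} → (Fin N → Fin M) → (Fin M → Fin N) → Vec (Fin N) N → Vec (Fin M) M
conj f g σ = tabulate (λ y → f (lookup σ (g y)))

lookup-conj : ∀ {N M} (f : Fin N → Fin M) g σ y → lookup (conj f g σ) y ≡ f (lookup σ (g y))
lookup-conj f g σ = VP.lookup∘tabulate (λ y → f (lookup σ (g y)))

conj-conj : ∀ {N M} (f : Fin N → Fin M) (g : Fin M → Fin N) f' g' →
  (∀ z → f' (f z) ≡ z) → (∀ x → g (g' x) ≡ x) → ∀ σ → conj f' g' (conj f g σ) ≡ σ
conj-conj f g f' g' f'f gg' σ = vec-ext λ x → begin
  lookup (conj f' g' (conj f g σ)) x ≡⟨ lookup-conj f' g' (conj f g σ) x ⟩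
  f' (lookup (conj f g σ) (g' x))    ≡⟨ cong f' (lookup-conj f g σ (g' x)) ⟩
  f' (f (lookup σ (g (g' x))))       ≡⟨ f'f _ ⟩
  lookup σ (g (g' x))                ≡⟨ cong (lookup σ) (gg' x) ⟩
  lookup σ x                         ∎
  where open ≡-Reasoning

conj-respects : ∀ {N M} {F : Constraint N} {G : Constraint M} (f : Fin N → Fin M) (g : Fin M → Fin N) →
  (∀ {z w} → f z ≡ f w → z ≡ w) → (∀ {y y'} → g y ≡ g y' → y ≡ y') →
  (∀ y z → G y (f z) ≡ F (g y) z) → ∀ σ → Respects F σ → Respects G (conj f g σ)
conj-respects {F = F} {G} f g f-inj g-inj agree σ (perm , ok) = perm′ , ok′
  where
  perm′ : IsPerm (conj f g σ)
  perm′ y y′ e = g-inj (perm _ _ (f-inj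
    (trans (sym (lookup-conj f g σ y)) (trans e (lookup-conj f g σ y′)))))
  ok′ : ∀ y → T (not (G y (lookup (conj f g σ) y)))
  ok′ y = subst (λ v → T (not (G y v))) (sym (lookup-conj f g σ y))
            (subst (T ∘ not) (sym (agree y (lookup σ (g y)))) (ok (g y)))

#-relabel : ∀ {N M} (ρ₁ ρ₂ : Fin N ↔ Fin M) (F : Constraint N) (G : Constraint M) →
  (∀ x y → G (to ρ₂ x) (to ρ₁ y) ≡ F x y) → # F ≡ # G
#-relabel ρ₁ ρ₂ F G agree = #-cong-↔ F G (Sat-↔ (respects? F) (respects? G)
  (conj (to ρ₁) (from ρ₂)) (conj (from ρ₁) (to ρ₂))
  (conj-respects {F = F} {G} (to ρ₁) (from ρ₂) (to-injective ρ₁) (from-injective ρ₂) forward)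
  (conj-respects {F = G} {F} (from ρ₁) (to ρ₂) (from-injective ρ₁) (to-injective ρ₂) backward)
  (λ τ _ → conj-conj (from ρ₁) (to ρ₂) (to ρ₁) (from ρ₂)
                     (strictlyInverseˡ ρ₁) (strictlyInverseˡ ρ₂) τ)
  (λ σ _ → conj-conj (to ρ₁) (from ρ₂) (from ρ₁) (to ρ₂)
                     (strictlyInverseʳ ρ₁) (strictlyInverseʳ ρ₂) σ))
  where
  forward : ∀ y z → G y (to ρ₁ z) ≡ F (from ρ₂ y) z
  forward y z = trans (cong (λ w → G w (to ρ₁ z)) (sym (strictlyInverseˡ ρ₂ y)))
                      (agree (from ρ₂ y) z)
  backward : ∀ x w → F x (from ρ₁ w) ≡ G (to ρ₂ x) w
  backward x w = trans (sym (agree x (from ρ₁ w))) (cong (G (to ρ₂ x)) (strictlyInverseˡ ρ₁ w))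

#-pointwise : ∀ {N} (F G : Constraint N) → (∀ x y → F x y ≡ G x y) → # F ≡ # G
#-pointwise F G e = #-relabel ↔-refl ↔-refl F G (λ x y → sym (e x y))

#-blocked : ∀ {N} (F : Constraint N) (a : Fin N) → (∀ y → F a y ≡ true) → # F ≡ 0
#-blocked F a blocked = size-unique (#-↔ F)
  (mk↔ₛ′ (λ { (σ , p) → ⊥-elim (impossible σ (toWitness p)) }) (λ ()) (λ ())
         (λ { (σ , p) → ⊥-elim (impossible σ (toWitness p)) }))
  where
  impossible : ∀ σ → Respects F σ → _
  impossible σ (_ , ok) = subst (T ∘ not) (blocked (lookup σ a)) (ok a)

pin : ∀ {N} → Constraint N → Fin N → Fin N → Constraint N
pin F a d x y = F x y ∨ (x == a ∧ not (y == d))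

pin-value : ∀ {N} (F : Constraint N) a d σ → Respects (pin F a d) σ → lookup σ a ≡ d
pin-value F a d σ (_ , ok) = ==-sound (T-not-not _
  (subst (λ b → T (not (b ∧ not (lookup σ a == d)))) (==-refl a) (proj₂ (avoid-∨⁻ _ _ (ok a)))))

pin-relax : ∀ {N} (F : Constraint N) a d σ → Respects (pin F a d) σ → Respects F σ
pin-relax F a d σ (perm , ok) = perm , λ x → proj₁ (avoid-∨⁻ _ _ (ok x))

pin-intro : ∀ {N} (F : Constraint N) a σ → Respects F σ → Respects (pin F a (lookup σ a)) σ
pin-intro F a σ (perm , ok) = perm , λ x → avoid-∨⁺ _ _ (ok x) (pinned x (x ≟ a))
  where
  pinned : ∀ x → Dec (x ≡ a) → T (not (x == a ∧ not (lookup σ x == lookup σ a)))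
  pinned x (yes refl) rewrite ==-refl x | ==-refl (lookup σ x) = _
  pinned x (no x≢a) rewrite ==-false x≢a = _

#-by-value : ∀ {N} (F : Constraint N) (a : Fin N) → # F ≡ ∑[ d < N ] # (pin F a d)
#-by-value {N} F a = size-unique (#-↔ F) (↔-trans byValue (Σ-sizes-↔ N _ (λ d → #-↔ (pin F a d))))
  where
  sameSolution : ∀ {d d′} (e : d ≡ d′) σ {p : True (respects? (pin F a d) σ)}
    {q : True (respects? (pin F a d′) σ)} →
    _≡_ {A = Σ (Fin N) (Solutions ∘ pin F a)} (d , σ , p) (d′ , σ , q)
  sameSolution refl σ = cong (_ ,_) (Sat-≡ (respects? (pin F a _)) refl)
  byValue : Solutions F ↔ Σ (Fin N) (Solutions ∘ pin F a)
  byValue = mk↔ₛ′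
    (λ { (σ , p) → lookup σ a , σ , fromWitness (pin-intro F a σ (toWitness p)) })
    (λ { (d , σ , q) → σ , fromWitness (pin-relax F a d σ (toWitness q)) })
    (λ { (d , σ , q) → sameSolution (pin-value F a d σ (toWitness q)) σ })
    (λ { (σ , p) → Sat-≡ (respects? F) refl })

data PunchView {N} (a : Fin (suc N)) : Fin (suc N) → Set where
  at      : PunchView a a
  punched : ∀ z → PunchView a (punchIn a z)

punchView : ∀ {N} (a y : Fin (suc N)) → PunchView a y
punchView a y with a ≟ y
... | yes refl = at
... | no a≢y   = subst (PunchView a) (FP.punchIn-punchOut a≢y) (punched (punchOut a≢y))

extend : ∀ {N} (a v : Fin (suc N)) → (Fin N → Fin (suc N)) → Fin (suc N) → Fin (suc N)
extend a v h y with a ≟ y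
... | yes _  = v
... | no a≢y = h (punchOut a≢y)

extend-at : ∀ {N} (a v : Fin (suc N)) h → extend a v h a ≡ v
extend-at a v h with a ≟ a
... | yes _  = refl
... | no a≢a = ⊥-elim (a≢a refl)

extend-punched : ∀ {N} (a v : Fin (suc N)) h z → extend a v h (punchIn a z) ≡ h z
extend-punched a v h z with a ≟ punchIn a z
... | yes a≡ = ⊥-elim (FP.punchInᵢ≢i a z (sym a≡))
... | no a≢  = cong h (trans (FP.punchOut-cong a refl) (FP.punchOut-punchIn a))

punchOut-or : ∀ {N} → Fin N → Fin (suc N) → Fin (suc N) → Fin N
punchOut-or w a y with a ≟ y
... | yes _  = w
... | no a≢y = punchOut a≢y

punchOut-or-punchIn : ∀ {N} (w : Fin N) a z → punchOut-or w a (punchIn a z) ≡ z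
punchOut-or-punchIn w a z with a ≟ punchIn a z
... | yes a≡ = ⊥-elim (FP.punchInᵢ≢i a z (sym a≡))
... | no a≢  = trans (FP.punchOut-cong a refl) (FP.punchOut-punchIn a)

punchIn-punchOut-or : ∀ {N} (w : Fin N) a y → a ≢ y → punchIn a (punchOut-or w a y) ≡ y
punchIn-punchOut-or w a y a≢y with a ≟ y
... | yes a≡y = ⊥-elim (a≢y a≡y)
... | no a≢y′ = FP.punchIn-punchOut a≢y′

module FixedPoint {N} (G : Constraint (suc N)) (a : Fin (suc N)) (Gaa : G a a ≡ false) where

  Deleted : Constraint N
  Deleted x y = G (punchIn a x) (punchIn a y)

  restricted : Vec (Fin (suc N)) (suc N) → Fin N → Fin N
  restricted σ x = punchOut-or x a (lookup σ (punchIn a x))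

  restrict : Vec (Fin (suc N)) (suc N) → Vec (Fin N) N
  restrict σ = tabulate (restricted σ)

  reinserted : Vec (Fin N) N → Fin (suc N) → Fin (suc N)
  reinserted τ = extend a a (λ z → punchIn a (lookup τ z))

  reinsert : Vec (Fin N) N → Vec (Fin (suc N)) (suc N)
  reinsert τ = tabulate (reinserted τ)

  reinsert-at : ∀ τ → lookup (reinsert τ) a ≡ a
  reinsert-at τ = trans (VP.lookup∘tabulate (reinserted τ) a) (extend-at a a _)

  reinsert-punched : ∀ τ z → lookup (reinsert τ) (punchIn a z) ≡ punchIn a (lookup τ z)
  reinsert-punched τ z =
    trans (VP.lookup∘tabulate (reinserted τ) (punchIn a z)) (extend-punched a a _ z)

  restrict-punched : ∀ σ → Respects (pin G a a) σ →
    ∀ x → punchIn a (lookup (restrict σ) x) ≡ lookup σ (punchIn a x)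
  restrict-punched σ p@(perm , _) x = trans (cong (punchIn a) (VP.lookup∘tabulate (restricted σ) x))
    (punchIn-punchOut-or x a _ λ a≡ →
      FP.punchInᵢ≢i a x (perm _ _ (trans (sym a≡) (sym (pin-value G a a σ p)))))

  restrict-respects : ∀ σ → Respects (pin G a a) σ → Respects Deleted (restrict σ)
  restrict-respects σ p@(perm , ok) = perm′ , ok′
    where
    perm′ : IsPerm (restrict σ)
    perm′ x x′ e = FP.punchIn-injective a x x′ (perm _ _
      (trans (sym (restrict-punched σ p x)) (trans (cong (punchIn a) e) (restrict-punched σ p x′))))
    ok′ : ∀ x → T (not (Deleted x (lookup (restrict σ) x)))
    ok′ x = subst (λ w → T (not (G (punchIn a x) w))) (sym (restrict-punched σ p x))
                  (proj₁ (avoid-∨⁻ _ _ (ok (punchIn a x))))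

  reinsert-respects : ∀ τ → Respects Deleted τ → Respects (pin G a a) (reinsert τ)
  reinsert-respects τ (perm , ok) = perm′ , ok′
    where
    perm′ : IsPerm (reinsert τ)
    perm′ y y′ e with punchView a y | punchView a y′
    ... | at        | at         = refl
    ... | at        | punched z  = ⊥-elim (FP.punchInᵢ≢i a (lookup τ z)
                                     (sym (trans (sym (reinsert-at τ)) (trans e (reinsert-punched τ z)))))
    ... | punched z | at         = ⊥-elim (FP.punchInᵢ≢i a (lookup τ z)
                                     (trans (sym (reinsert-punched τ z)) (trans e (reinsert-at τ))))
    ... | punched z | punched z′ = cong (punchIn a) (perm z z′ (FP.punchIn-injective a _ _
                                     (trans (sym (reinsert-punched τ z)) (trans e (reinsert-punched τ z′)))))
    ok′ : ∀ y → T (not (pin G a a y (lookup (reinsert τ) y)))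
    ok′ y with punchView a y
    ... | at rewrite reinsert-at τ | Gaa | ==-refl a = _
    ... | punched z rewrite reinsert-punched τ z | ==-false (FP.punchInᵢ≢i a z) =
      avoid-∨⁺ _ _ (ok z) _

  reinsert-restrict : ∀ σ → Respects (pin G a a) σ → reinsert (restrict σ) ≡ σ
  reinsert-restrict σ p = vec-ext λ y → agree y (punchView a y)
    where
    agree : ∀ y → PunchView a y → lookup (reinsert (restrict σ)) y ≡ lookup σ y
    agree y at          = trans (reinsert-at (restrict σ)) (sym (pin-value G a a σ p))
    agree y (punched z) = trans (reinsert-punched (restrict σ) z) (restrict-punched σ p z)

  restrict-reinsert : ∀ τ → restrict (reinsert τ) ≡ τ
  restrict-reinsert τ = vec-ext λ x → trans (VP.lookup∘tabulate (restricted (reinsert τ)) x)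
    (trans (cong (punchOut-or x a) (reinsert-punched τ x)) (punchOut-or-punchIn x a _))

  #-deleted : # (pin G a a) ≡ # Deleted
  #-deleted = #-cong-↔ (pin G a a) Deleted (Sat-↔ (respects? (pin G a a)) (respects? Deleted)
    restrict reinsert restrict-respects reinsert-respects (λ τ _ → restrict-reinsert τ) reinsert-restrict)

-- Contraction: forcing a ↦ d (allowed by F) amounts to deleting a, once the
-- values a and d are exchanged so that a ↦ d becomes a fixed point.
#-contract : ∀ {N} (F : Constraint (suc N)) (a d : Fin (suc N)) → F a d ≡ false →
  # (pin F a d) ≡ # (λ x y → F (punchIn a x) (PC.transpose d a (punchIn a y)))
#-contract F a d Fad = begin
  # pin F a d    ≡⟨ #-relabel (transpose-↔ a d) ↔-refl (pin F a d) pinTransposed undoTranspose ⟩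
  # pinTransposed ≡⟨ #-pointwise pinTransposed (pin F′ a a) pinnedToItself ⟩
  # pin F′ a a    ≡⟨ FixedPoint.#-deleted F′ a F′aa ⟩
  # FixedPoint.Deleted F′ a F′aa ∎
  where
  open ≡-Reasoning
  pinTransposed : Constraint _
  pinTransposed x y = pin F a d x (PC.transpose d a y)
  F′ : Constraint _
  F′ x y = F x (PC.transpose d a y)
  F′aa : F′ a a ≡ false
  F′aa = trans (cong (F a) (transpose-j d a)) Fad
  undoTranspose : ∀ x y → pin F a d x (PC.transpose d a (PC.transpose a d y)) ≡ pin F a d x y
  undoTranspose x y = cong (pin F a d x) (PC.transpose-inverse d a)
  transposed-d : ∀ y → (PC.transpose d a y == d) ≡ (y == a)
  transposed-d y = ==-cong {x = PC.transpose d a y} {d} {y} {a}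
    (λ e → trans (sym (PC.transpose-inverse a d)) (trans (cong (PC.transpose a d) e) (transpose-j a d)))
    (λ e → trans (cong (PC.transpose d a) e) (transpose-j d a))
  pinnedToItself : ∀ x y → pin F a d x (PC.transpose d a y) ≡ pin F′ a a x y
  pinnedToItself x y = cong (λ b → F′ x y ∨ (x == a ∧ not b)) (transposed-d y)

SameColour : ∀ {N m} → (Fin N → Fin m) → Constraint N
SameColour col x y = col x == col y

IntoColour : ∀ {N m} → (Fin N → Fin m) → Fin N → Fin m → Constraint N
IntoColour col a i x y = SameColour col x y ∨ (x == a ∧ not (col y == i))

-- a may go anywhere outside colour i (its own colour included);
-- the other points obey the generalized-derangement constraint.
AvoidColour : ∀ {N m} → (Fin N → Fin m) → Fin N → Fin m → Constraint N
AvoidColour col a i x y = if x == a then col y == i else SameColour col x y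

classSize : ∀ {N m} → (Fin N → Fin m) → Fin m → ℕ
classSize {N} col j = ∑[ x < N ] χ (col x ≟ j)

#pin-into : ∀ {N m} (col : Fin N → Fin m) (a : Fin N) (i : Fin m) d →
  # pin (IntoColour col a i) a d ≡ χ (col d ≟ i) * # pin (SameColour col) a d
#pin-into col a i d with col d ≟ i
... | yes cd≡i = trans (#-pointwise _ _ agree) (sym (NP.+-identityʳ _))
  where
  agree : ∀ x y → pin (IntoColour col a i) a d x y ≡ pin (SameColour col) a d x y
  agree x y with x ≟ a | y ≟ d
  ... | no x≢a   | _        = ∨-identityʳ (SameColour col x y ∨ false)
  ... | yes refl | yes refl rewrite ==-true cd≡i =
    ∨-identityʳ (SameColour col x y ∨ false)
  ... | yes refl | no y≢d   = trans (∨-zeroʳ _) (sym (∨-zeroʳ _))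
... | no cd≢i = #-blocked (pin (IntoColour col a i) a d) a blocked
  where
  blocked : ∀ y → pin (IntoColour col a i) a d a y ≡ true
  blocked y with y ≟ d
  ... | yes refl rewrite ==-refl a | ==-false cd≢i = trans (∨-identityʳ _) (∨-zeroʳ _)
  ... | no y≢d   rewrite ==-refl a = ∨-zeroʳ _

#into-by-value : ∀ {N m} (col : Fin N → Fin m) (a : Fin N) (i : Fin m) →
  # IntoColour col a i ≡ ∑[ d < N ] (χ (col d ≟ i) * # pin (SameColour col) a d)
#into-by-value {N} col a i =
  trans (#-by-value (IntoColour col a i) a) (sum-cong-≗ (#pin-into col a i))

#pin-own-colour : ∀ {N m} (col : Fin N → Fin m) (a d : Fin N) → col d ≡ col a →
  # pin (SameColour col) a d ≡ 0
#pin-own-colour col a d cd≡ca = #-blocked (pin (SameColour col) a d) a blocked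
  where
  blocked : ∀ y → pin (SameColour col) a d a y ≡ true
  blocked y with y ≟ d
  ... | yes refl rewrite ==-true (sym cd≡ca) = refl
  ... | no y≢d   rewrite ==-refl a = ∨-zeroʳ _

-- Contracting a generalized derangement along a ↦ d (different colours): after
-- deleting a, the point d carries a's colour, and its old position a₁ may not
-- go to d's old colour.
#pin-contract : ∀ {N m} (col : Fin (suc N) → Fin m) (a d : Fin (suc N)) (a₁ : Fin N) →
  punchIn a a₁ ≡ d → col d ≢ col a →
  # pin (SameColour col) a d ≡ # AvoidColour (col ∘ PC.transpose d a ∘ punchIn a) a₁ (col d)
#pin-contract col a d a₁ a₁↦d cd≢ca =
  trans (#-contract (SameColour col) a d (==-false (cd≢ca ∘ sym))) (#-pointwise _ _ agree)
  where
  agree : ∀ x y → SameColour col (punchIn a x) (PC.transpose d a (punchIn a y))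
                ≡ AvoidColour (col ∘ PC.transpose d a ∘ punchIn a) a₁ (col d) x y
  agree x y with x ≟ a₁
  ... | yes refl rewrite a₁↦d =
    ==-cong {x = col d} {y = col (PC.transpose d a (punchIn a y))} sym sym
  ... | no x≢a₁ =
    cong (λ z → z == col (PC.transpose d a (punchIn a y))) (cong col (sym (transpose-other
      (λ x↦d → x≢a₁ (FP.punchIn-injective a x a₁ (trans x↦d (sym a₁↦d))))
      (FP.punchInᵢ≢i a x))))

-- Termwise comparison of #-by-value for AvoidColour and SameColour (col a ≢ i):
-- images of colour i are excluded by AvoidColour, images e of a's own colour
-- are newly allowed and contract to Q solutions each, all others agree.
#pin-avoid : ∀ {M m} (col : Fin (suc M) → Fin m) (a : Fin (suc M)) (i : Fin m) → col a ≢ i →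
  (Q : ℕ) → (∀ e → col e ≡ col a → # SameColour (col ∘ PC.transpose e a ∘ punchIn a) ≡ Q) →
  ∀ e → # pin (AvoidColour col a i) a e + χ (col e ≟ i) * # pin (SameColour col) a e
      ≡ χ (col e ≟ col a) * Q + # pin (SameColour col) a e
#pin-avoid col a i ca≢i Q ownColour e with col e ≟ i | col e ≟ col a
... | yes ce≡i | yes ce≡ca = ⊥-elim (ca≢i (trans (sym ce≡ca) ce≡i))
... | yes ce≡i | no _      =
  trans (cong (_+ (# pin (SameColour col) a e + 0)) (#-blocked (pin (AvoidColour col a i) a e) a blocked))
        (NP.+-identityʳ _)
  where
  blocked : ∀ y → pin (AvoidColour col a i) a e a y ≡ true
  blocked y with y ≟ e
  ... | yes refl rewrite ==-refl a | ==-true ce≡i = refl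
  ... | no _     rewrite ==-refl a = ∨-zeroʳ _
... | no ce≢i  | yes ce≡ca = begin
  # pin (AvoidColour col a i) a e + 0      ≡⟨ NP.+-identityʳ _ ⟩
  # pin (AvoidColour col a i) a e          ≡⟨ #-contract (AvoidColour col a i) a e allowed ⟩
  # (λ x y → AvoidColour col a i (punchIn a x) (PC.transpose e a (punchIn a y)))
    ≡⟨ #-pointwise _ _ agree ⟩
  # SameColour (col ∘ PC.transpose e a ∘ punchIn a)
    ≡⟨ ownColour e ce≡ca ⟩
  Q                                        ≡⟨ sym (trans (NP.+-identityʳ (Q + 0)) (NP.+-identityʳ Q)) ⟩
  Q + 0 + 0                                ≡⟨ cong (Q + 0 +_) (sym (#pin-own-colour col a e ce≡ca)) ⟩
  Q + 0 + # pin (SameColour col) a e       ∎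
  where
  open ≡-Reasoning
  allowed : AvoidColour col a i a e ≡ false
  allowed rewrite ==-refl a = ==-false ce≢i
  agree : ∀ x y → AvoidColour col a i (punchIn a x) (PC.transpose e a (punchIn a y))
                ≡ SameColour (col ∘ PC.transpose e a ∘ punchIn a) x y
  agree x y rewrite ==-false (FP.punchInᵢ≢i a x) =
    cong (_== col (PC.transpose e a (punchIn a y)))
         (sym (transpose-colour col e a (punchIn a x) ce≡ca))
... | no ce≢i  | no ce≢ca  = trans (NP.+-identityʳ _) (#-pointwise _ _ agree)
  where
  agree : ∀ x y → pin (AvoidColour col a i) a e x y ≡ pin (SameColour col) a e x y
  agree x y with x ≟ a | y ≟ e
  ... | no _     | _        = refl
  ... | yes refl | yes refl rewrite ==-false ce≢i | ==-false (ce≢ca ∘ sym) = refl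
  ... | yes refl | no _     = trans (∨-zeroʳ _) (sym (∨-zeroʳ _))

-- Summing #pin-avoid over e: when col a ≢ i, the permutations where a avoids
-- colour i together with those where a goes into colour i are the generalized
-- derangements plus those sending a into its own colour.
#avoid+#into : ∀ {M m} (col : Fin (suc M) → Fin m) (a : Fin (suc M)) (i : Fin m) → col a ≢ i →
  (Q : ℕ) → (∀ e → col e ≡ col a → # SameColour (col ∘ PC.transpose e a ∘ punchIn a) ≡ Q) →
  # AvoidColour col a i + # IntoColour col a i ≡ classSize col (col a) * Q + # SameColour col
#avoid+#into {M} col a i ca≢i Q ownColour = begin
  # AvoidColour col a i + # IntoColour col a i
    ≡⟨ cong₂ _+_ (#-by-value (AvoidColour col a i) a) (#into-by-value col a i) ⟩
  ∑[ e < suc M ] avoid e + ∑[ e < suc M ] (χ (col e ≟ i) * same e)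
    ≡⟨ sym (∑-distrib-+ avoid (λ e → χ (col e ≟ i) * same e)) ⟩
  ∑[ e < suc M ] (avoid e + χ (col e ≟ i) * same e)
    ≡⟨ sum-cong-≗ (#pin-avoid col a i ca≢i Q ownColour) ⟩
  ∑[ e < suc M ] (χ (col e ≟ col a) * Q + same e)
    ≡⟨ ∑-distrib-+ (λ e → χ (col e ≟ col a) * Q) same ⟩
  ∑[ e < suc M ] (χ (col e ≟ col a) * Q) + ∑[ e < suc M ] same e
    ≡⟨ cong₂ _+_ (sym (*-distribʳ-sum Q (λ e → χ (col e ≟ col a))))
                 (sym (#-by-value (SameColour col) a)) ⟩
  classSize col (col a) * Q + # SameColour col ∎
  where
  open ≡-Reasoning
  avoid same : Fin (suc M) → ℕ
  avoid e = # pin (AvoidColour col a i) a e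
  same  e = # pin (SameColour col) a e

classSize-punchIn : ∀ {N m} (col : Fin (suc N) → Fin m) a j →
  classSize col j ≡ χ (col a ≟ j) + classSize (col ∘ punchIn a) j
classSize-punchIn col a j = sum-remove {i = a} (λ x → χ (col x ≟ j))

classSize-permute : ∀ {N m} (col : Fin N → Fin m) (ρ : Fin N ↔ Fin N) j →
  classSize col j ≡ classSize (col ∘ to ρ) j
classSize-permute col ρ j = ∑-permute (λ x → χ (col x ≟ j)) ρ

classSize-contract : ∀ {N m} (col : Fin (suc N) → Fin m) a d j →
  classSize col j ≡ χ (col d ≟ j) + classSize (col ∘ PC.transpose d a ∘ punchIn a) j
classSize-contract col a d j = begin
  classSize col j
    ≡⟨ classSize-permute col (transpose-↔ d a) j ⟩
  classSize (col ∘ PC.transpose d a) j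
    ≡⟨ classSize-punchIn (col ∘ PC.transpose d a) a j ⟩
  χ (col (PC.transpose d a a) ≟ j) + classSize (col ∘ PC.transpose d a ∘ punchIn a) j
    ≡⟨ cong (λ c → χ (col c ≟ j) + classSize (col ∘ PC.transpose d a ∘ punchIn a) j) (transpose-j d a) ⟩
  χ (col d ≟ j) + classSize (col ∘ PC.transpose d a ∘ punchIn a) j ∎
  where open ≡-Reasoning

Class : ∀ {N m} → (Fin N → Fin m) → Fin m → Set
Class col j = Sat (λ x → col x ≟ j)

Class-↔ : ∀ {N m} (col : Fin N → Fin m) j → Class col j ↔ Fin (classSize col j)
Class-↔ {N} col j = Σ-sizes-↔ N _ (λ x → True-↔ (col x ≟ j))

byColour : ∀ {N m} (col : Fin N → Fin m) → Fin N ↔ Σ (Fin m) (Class col)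
byColour {N} {m} col = mk↔ₛ′ (λ x → col x , x , fromWitness refl) (λ { (j , x , _) → x })
  (λ { (j , x , p) → ownClass (toWitness p) }) (λ x → refl)
  where
  ownClass : ∀ {x j} {p : True (col x ≟ j)} (e : col x ≡ j) →
    _≡_ {A = Σ (Fin m) (Class col)} (col x , x , fromWitness refl) (j , x , p)
  ownClass refl = cong (_ ,_) (Sat-≡ (λ z → col z ≟ _) refl)

-- Colourings with the same class sizes differ by a colour-preserving bijection,
-- obtained by matching the classes one by one.
module ColourPreserving {N M m} (col : Fin N → Fin m) (col′ : Fin M → Fin m)
  (sameSizes : ∀ j → classSize col j ≡ classSize col′ j) where

  matchClass : ∀ j → Class col j ↔ Class col′ j
  matchClass j = ↔-trans (Class-↔ col j)
    (↔-sym (subst (λ c → Class col′ j ↔ Fin c) (sym (sameSizes j)) (Class-↔ col′ j)))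

  ρ : Fin N ↔ Fin M
  ρ = ↔-trans (byColour col) (↔-trans (Σ-↔ ↔-refl (matchClass _)) (↔-sym (byColour col′)))

  preserves : ∀ x → col′ (to ρ x) ≡ col x
  preserves x = toWitness (proj₂ (to (matchClass (col x)) (x , fromWitness refl)))

#same-relabel : ∀ {N M m} (col : Fin N → Fin m) (col′ : Fin M → Fin m) →
  (∀ j → classSize col j ≡ classSize col′ j) → # SameColour col ≡ # SameColour col′
#same-relabel col col′ sameSizes =
  #-relabel ρ ρ (SameColour col) (SameColour col′) (λ x y → cong₂ _==_ (preserves x) (preserves y))
  where open ColourPreserving col col′ sameSizes

#into-relabel : ∀ {N M m} (col : Fin N → Fin m) (col′ : Fin M → Fin m) →
  (∀ j → classSize col j ≡ classSize col′ j) →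
  ∀ a a′ i → col a ≡ col′ a′ → # IntoColour col a i ≡ # IntoColour col′ a′ i
#into-relabel col col′ sameSizes a a′ i ca≡ca′ =
  #-relabel ρ′ ρ′ (IntoColour col a i) (IntoColour col′ a′ i) agree
  where
  open ColourPreserving col col′ sameSizes
  -- follow ρ by the transposition moving the image of a to a′
  ρ′ : _ ↔ _
  ρ′ = ↔-trans ρ (transpose-↔ (to ρ a) a′)
  preserves′ : ∀ x → col′ (to ρ′ x) ≡ col x
  preserves′ x = trans (transpose-colour col′ (to ρ a) a′ (to ρ x) (trans (preserves a) ca≡ca′))
                       (preserves x)
  hitsA′ : ∀ x → (to ρ′ x == a′) ≡ (x == a)
  hitsA′ x = ==-cong {x = to ρ′ x} {a′} {x} {a}
    (λ e → to-injective ρ′ (trans e (sym (transpose-i (to ρ a) a′))))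
    (λ { refl → transpose-i (to ρ a) a′ })
  agree : ∀ x y → IntoColour col′ a′ i (to ρ′ x) (to ρ′ y) ≡ IntoColour col a i x y
  agree x y = cong₂ _∨_ (cong₂ _==_ (preserves′ x) (preserves′ y))
                        (cong₂ _∧_ (hitsA′ x) (cong (λ c → not (c == i)) (preserves′ y)))

block-left : ∀ {n} k (ts : Vec ℕ n) (x : Fin k) → block (k V.∷ ts) (x ↑ˡ sum ts) ≡ zero
block-left k ts x rewrite FP.splitAt-↑ˡ k x (sum ts) = refl

block-right : ∀ {n} k (ts : Vec ℕ n) (y : Fin (sum ts)) → block (k V.∷ ts) (k ↑ʳ y) ≡ suc (block ts y)
block-right k ts y rewrite FP.splitAt-↑ʳ k (sum ts) y = refl

classSize-block : ∀ {n} (t : Vec ℕ n) j → classSize (block t) j ≡ lookup t j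
classSize-block (k V.∷ ts) j = begin
  classSize (block (k V.∷ ts)) j
    ≡⟨ ∑-split k (sum ts) (λ x → χ (block (k V.∷ ts) x ≟ j)) ⟩
  ∑[ x < k ] χ (block (k V.∷ ts) (x ↑ˡ sum ts) ≟ j) + ∑[ y < sum ts ] χ (block (k V.∷ ts) (k ↑ʳ y) ≟ j)
    ≡⟨ cong₂ _+_ (sum-cong-≗ (λ x → cong (λ c → χ (c ≟ j)) (block-left k ts x)))
                 (sum-cong-≗ (λ y → cong (λ c → χ (c ≟ j)) (block-right k ts y))) ⟩
  ∑[ x < k ] χ (zero ≟ j) + ∑[ y < sum ts ] χ (suc (block ts y) ≟ j)
    ≡⟨ headOrTail j ⟩
  lookup (k V.∷ ts) j ∎
  where
  open ≡-Reasoning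
  headOrTail : ∀ j → ∑[ x < k ] χ (zero ≟ j) + ∑[ y < sum ts ] χ (suc (block ts y) ≟ j)
                   ≡ lookup (k V.∷ ts) j
  headOrTail zero    = trans (cong₂ _+_ (∑-ones k) (sum-replicate-zero (sum ts))) (NP.+-identityʳ k)
  headOrTail (suc j) = cong₂ _+_ (sum-replicate-zero k) (classSize-block ts j)

avoid-==⁻ : ∀ {N} {u v : Fin N} → T (not (u == v)) → u ≢ v
avoid-==⁻ ok u≡v = subst (T ∘ not) (==-true u≡v) ok

avoid-==⁺ : ∀ {N} {u v : Fin N} → u ≢ v → T (not (u == v))
avoid-==⁺ u≢v = subst (T ∘ not) (sym (==-false u≢v)) _

P-as-# : ∀ {n} (t : Vec ℕ n) → P t ≡ # SameColour (block t)
P-as-# t = cong length (filter-≐ (isGD? t) (respects? (SameColour (block t)))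
  ((λ { (perm , ok) → perm , λ x → avoid-==⁺ (ok x ∘ sym) }) ,
   (λ { (perm , ok) → perm , λ x e → avoid-==⁻ (ok x) (sym e) }))
  (allMaps (sum t) (sum t)))

filterInto-as-# : ∀ {n} k (ts : Vec ℕ n) (i : Fin (suc n)) → let t = suc k V.∷ ts in
  length (filter (λ σ → isGD? t σ ×-dec (block t (lookup σ zero) ≟ i)) (allMaps (sum t) (sum t)))
    ≡ # IntoColour (block t) zero i
filterInto-as-# k ts i = cong length (filter-≐ _ (respects? (IntoColour col zero i))
  ((λ { {σ} ((perm , ok) , σa∈i) →
          perm , λ x → avoid-∨⁺ _ _ (avoid-==⁺ (ok x ∘ sym)) (intoI σ σa∈i x) }) ,
   (λ { (perm , ok) → (perm , λ x e → avoid-==⁻ (proj₁ (avoid-∨⁻ _ _ (ok x))) (sym e)) ,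
                        ==-sound (T-not-not _ (proj₂ (avoid-∨⁻ _ _ (ok zero)))) }))
  (allMaps (sum t) (sum t)))
  where
  t = suc k V.∷ ts
  col = block t
  intoI : ∀ (σ : Vec (Fin (sum t)) (sum t)) → col (lookup σ zero) ≡ i →
    ∀ x → T (not (x == zero ∧ not (col (lookup σ x) == i)))
  intoI σ σa∈i zero    rewrite ==-true σa∈i = _
  intoI σ σa∈i (suc x) = _

g-as-# : ∀ {n} k (ts : Vec ℕ n) (i : Fin (suc n)) →
  g i (suc k V.∷ ts) ≡ # IntoColour (block (suc k V.∷ ts)) zero i
g-as-# k ts zero    = filterInto-as-# k ts zero
g-as-# k ts (suc i) = filterInto-as-# k ts (suc i)

lookup-decrement : ∀ {n} (t : Vec ℕ n) p j → lookup t p > 0 →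
  χ (p ≟ j) + lookup (t [ p ]%= (_∸ 1)) j ≡ lookup t j
lookup-decrement t p j tp>0 with p ≟ j
... | yes refl = trans (cong suc (VP.lookup∘updateAt p t)) (NP.m+[n∸m]≡n tp>0)
... | no p≢j   = VP.lookup∘updateAt′ j p (p≢j ∘ sym) t

classSize-after-contract : ∀ {N m} (col : Fin (suc N) → Fin m) a d (t : Vec ℕ m) p →
  col d ≡ p → lookup t p > 0 → (∀ j → classSize col j ≡ lookup t j) →
  ∀ j → classSize (col ∘ PC.transpose d a ∘ punchIn a) j ≡ lookup (t [ p ]%= (_∸ 1)) j
classSize-after-contract col a d t p cd≡p tp>0 sizes j =
  NP.+-cancelˡ-≡ (χ (col d ≟ j)) _ _ (begin
    χ (col d ≟ j) + classSize (col ∘ PC.transpose d a ∘ punchIn a) j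
      ≡⟨ sym (classSize-contract col a d j) ⟩
    classSize col j
      ≡⟨ sizes j ⟩
    lookup t j
      ≡⟨ sym (lookup-decrement t p j tp>0) ⟩
    χ (p ≟ j) + lookup (t [ p ]%= (_∸ 1)) j
      ≡⟨ cong (λ c → χ (c ≟ j) + lookup (t [ p ]%= (_∸ 1)) j) (sym cd≡p) ⟩
    χ (col d ≟ j) + lookup (t [ p ]%= (_∸ 1)) j ∎)
  where open ≡-Reasoning

P-from-sizes : ∀ {N n} (col : Fin N → Fin n) (t : Vec ℕ n) →
  (∀ j → classSize col j ≡ lookup t j) → # SameColour col ≡ P t
P-from-sizes col t sizes =
  trans (#same-relabel col (block t) (λ j → trans (sizes j) (sym (classSize-block t j))))
        (sym (P-as-# t))

g-from-sizes : ∀ {N n} (col : Fin N → Fin (suc n)) k (ts : Vec ℕ n) →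
  (∀ j → classSize col j ≡ lookup (suc k V.∷ ts) j) →
  ∀ a i → col a ≡ zero → # IntoColour col a i ≡ g i (suc k V.∷ ts)
g-from-sizes col k ts sizes a i ca≡0 =
  trans (#into-relabel col (block t) (λ j → trans (sizes j) (sym (classSize-block t j))) a zero i ca≡0)
        (sym (g-as-# k ts i))
  where t = suc k V.∷ ts

#avoid+#into-sizes : ∀ {N n} (col : Fin N → Fin (suc n)) (t : Vec ℕ (suc n)) →
  (∀ j → classSize col j ≡ lookup t j) → lookup t zero > 0 →
  ∀ a (i : Fin n) → col a ≡ zero →
  # AvoidColour col a (suc i) + # IntoColour col a (suc i)
    ≡ lookup t zero * P (t [ zero ]%= (_∸ 1)) + P t
#avoid+#into-sizes {suc M} col t sizes t₁>0 a i ca≡0 = begin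
  # AvoidColour col a (suc i) + # IntoColour col a (suc i)
    ≡⟨ #avoid+#into col a (suc i) (λ e → FP.0≢1+n (trans (sym ca≡0) e)) (P t⁻) ownColour ⟩
  classSize col (col a) * P t⁻ + # SameColour col
    ≡⟨ cong₂ _+_ (cong (_* P t⁻) (trans (cong (classSize col) ca≡0) (sizes zero)))
                 (P-from-sizes col t sizes) ⟩
  lookup t zero * P t⁻ + P t ∎
  where
  open ≡-Reasoning
  t⁻ = t [ zero ]%= (_∸ 1)
  ownColour : ∀ e → col e ≡ col a → # SameColour (col ∘ PC.transpose e a ∘ punchIn a) ≡ P t⁻
  ownColour e ce≡ca = P-from-sizes (col ∘ PC.transpose e a ∘ punchIn a) t⁻
    (classSize-after-contract col a e t zero (trans ce≡ca ca≡0) t₁>0 sizes)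

module FirstClassNonempty {n} (k : ℕ) (ts : Vec ℕ n) where

  t : Vec ℕ (suc n)
  t = suc k V.∷ ts

  col : Fin (sum t) → Fin (suc n)
  col = block t

  fixedImage : Fin (sum t) → ℕ
  fixedImage d = # pin (SameColour col) zero d

  P-by-image : P t ≡ ∑[ d < sum t ] fixedImage d
  P-by-image = trans (P-as-# t) (#-by-value (SameColour col) zero)

  g-by-image : ∀ i → g i t ≡ ∑[ d < sum t ] (χ (col d ≟ i) * fixedImage d)
  g-by-image i = trans (g-as-# k ts i) (#into-by-value col zero i)

  g-first≡0 : g zero t ≡ 0
  g-first≡0 = trans (g-by-image zero) (∑-vanishes (sum t) _ term≡0)
    where
    term≡0 : ∀ d → χ (col d ≟ zero) * fixedImage d ≡ 0
    term≡0 d with col d ≟ zero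
    ... | yes cd≡0 = trans (NP.+-identityʳ _) (#pin-own-colour col zero d cd≡0)
    ... | no _     = refl

  g-empty≡0 : ∀ i → lookup t i ≡ 0 → g i t ≡ 0
  g-empty≡0 i ti≡0 = trans (g-by-image i) (∑-vanishes (sum t) _ term≡0)
    where
    term≡0 : ∀ d → χ (col d ≟ i) * fixedImage d ≡ 0
    term≡0 d = cong (_* fixedImage d)
      (∑≡0⇒≡0 (sum t) (λ x → χ (col x ≟ i)) (trans (classSize-block t i) ti≡0) d)

  -- (c) every generalized derangement sends a into exactly one class.
  P≡∑g : P t ≡ sum (tabulate (λ i → g i t))
  P≡∑g = begin
    P t
      ≡⟨ P-by-image ⟩
    ∑[ d < sum t ] fixedImage d
      ≡⟨ sum-cong-≗ (λ d → sym (∑-δ (suc n) (col d) (fixedImage d))) ⟩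
    ∑[ d < sum t ] ∑[ i < suc n ] (χ (col d ≟ i) * fixedImage d)
      ≡⟨ ∑-comm (λ d i → χ (col d ≟ i) * fixedImage d) ⟩
    ∑[ i < suc n ] ∑[ d < sum t ] (χ (col d ≟ i) * fixedImage d)
      ≡⟨ sum-cong-≗ (λ i → sym (g-by-image i)) ⟩
    ∑[ i < suc n ] g i t
      ≡⟨ sym (sum-tabulate (suc n) (λ i → g i t)) ⟩
    sum (tabulate (λ i → g i t)) ∎
    where open ≡-Reasoning

  -- (b) Fix i ≠ 1 with t_i > 0.  Every image d of colour i contributes the same amount.
  module _ (i : Fin n) (ti>0 : lookup t (suc i) > 0) where

    t-eᵢ t-e₁-eᵢ : Vec ℕ (suc n)
    t-eᵢ = t [ suc i ]%= (_∸ 1)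
    t-e₁-eᵢ = (t [ zero ]%= (_∸ 1)) [ suc i ]%= (_∸ 1)

    -- Contracting a ↦ d leaves a colouring with class sizes t - eᵢ in which d's
    -- old position a₁ has colour 1: Avoid/Into for it give fixedImage d and g_i(t - eᵢ).
    fixedImage+g : ∀ d → col d ≡ suc i →
      fixedImage d + g (suc i) t-eᵢ ≡ suc k * P t-e₁-eᵢ + P t-eᵢ
    fixedImage+g d cd≡i with punchView zero d
    ... | at         = ⊥-elim (FP.0≢1+n cd≡i)
    ... | punched a₁ = begin
      fixedImage d + g (suc i) t-eᵢ
        ≡⟨ cong₂ _+_ (#pin-contract col zero d a₁ refl (λ cd≡0 → FP.0≢1+n (trans (sym cd≡0) cd≡i)))
                     (sym (g-from-sizes col₁ k (ts V.[ i ]%= (_∸ 1)) sizes₁ a₁ (suc i) col₁a₁≡0)) ⟩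
      # AvoidColour col₁ a₁ (col d) + # IntoColour col₁ a₁ (suc i)
        ≡⟨ cong (λ c → # AvoidColour col₁ a₁ c + # IntoColour col₁ a₁ (suc i)) cd≡i ⟩
      # AvoidColour col₁ a₁ (suc i) + # IntoColour col₁ a₁ (suc i)
        ≡⟨ #avoid+#into-sizes col₁ t-eᵢ sizes₁ (NP.0<1+n {k}) a₁ i col₁a₁≡0 ⟩
      suc k * P t-e₁-eᵢ + P t-eᵢ ∎
      where
      open ≡-Reasoning
      col₁ : Fin (k + sum ts) → Fin (suc n)
      col₁ = col ∘ PC.transpose d zero ∘ punchIn zero
      col₁a₁≡0 : col₁ a₁ ≡ zero
      col₁a₁≡0 = cong col (transpose-i d zero)
      sizes₁ : ∀ j → classSize col₁ j ≡ lookup t-eᵢ j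
      sizes₁ = classSize-after-contract col zero d t (suc i) cd≡i ti>0 (classSize-block t)

    fixedImage≡ : ∀ d → col d ≡ suc i →
      fixedImage d ≡ suc k * P t-e₁-eᵢ + P t-eᵢ ∸ g (suc i) t-eᵢ
    fixedImage≡ d cd≡i = trans (sym (NP.m+n∸n≡m (fixedImage d) (g (suc i) t-eᵢ)))
                               (cong (_∸ g (suc i) t-eᵢ) (fixedImage+g d cd≡i))

    g-recursion : g (suc i) t ≡ lookup t (suc i) * (suc k * P t-e₁-eᵢ + P t-eᵢ ∸ g (suc i) t-eᵢ)
    g-recursion = begin
      g (suc i) t
        ≡⟨ g-by-image (suc i) ⟩
      ∑[ d < sum t ] (χ (col d ≟ suc i) * fixedImage d)
        ≡⟨ sum-cong-≗ term ⟩
      ∑[ d < sum t ] (χ (col d ≟ suc i) * K)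
        ≡⟨ sym (*-distribʳ-sum K (λ d → χ (col d ≟ suc i))) ⟩
      classSize col (suc i) * K
        ≡⟨ cong (_* K) (classSize-block t (suc i)) ⟩
      lookup t (suc i) * K ∎
      where
      open ≡-Reasoning
      K = suc k * P t-e₁-eᵢ + P t-eᵢ ∸ g (suc i) t-eᵢ
      term : ∀ d → χ (col d ≟ suc i) * fixedImage d ≡ χ (col d ≟ suc i) * K
      term d with col d ≟ suc i
      ... | yes cd≡i = cong (_+ 0) (fixedImage≡ d cd≡i)
      ... | no _     = refl

P≡∑g-first-empty : ∀ {n} (ts : Vec ℕ n) → P (0 V.∷ ts) ≡ sum (tabulate (λ i → g i (0 V.∷ ts)))
P≡∑g-first-empty {n} ts = sym (begin
  sum (tabulate (λ i → g i (0 V.∷ ts)))  ≡⟨ sum-tabulate (suc n) (λ i → g i (0 V.∷ ts)) ⟩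
  P (0 V.∷ ts) + ∑[ i < n ] 0            ≡⟨ cong (P (0 V.∷ ts) +_) (sum-replicate-zero n) ⟩
  P (0 V.∷ ts) + 0                       ≡⟨ NP.+-identityʳ _ ⟩
  P (0 V.∷ ts)                           ∎)
  where open ≡-Reasoning

theorem3p1 : (n : ℕ) → (t : Vec ℕ (suc n)) →
    ((lookup t zero > 0 →
        (g zero t ≡ 0) × (∀ (i : Fin (suc n)) → lookup t i ≡ 0 → g i t ≡ 0))
    × (∀ (i : Fin n) → lookup t zero > 0 → lookup t (suc i) > 0 →
        g (suc i) t
          ≡ lookup t (suc i)
            * (lookup t zero * P ((t [ zero ]%= (_∸ 1)) [ suc i ]%= (_∸ 1))
               + P (t [ suc i ]%= (_∸ 1))
               ∸ g (suc i) (t [ suc i ]%= (_∸ 1)))))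
    × (P t ≡ sum (tabulate (λ i → g i t)))
theorem3p1 n (zero V.∷ ts) = ((λ ()) , (λ _ ())) , P≡∑g-first-empty ts
theorem3p1 n (suc k V.∷ ts) =
  ((λ _ → g-first≡0 , g-empty≡0) , (λ i _ ti>0 → g-recursion i ti>0)) , P≡∑g
  where open FirstClassNonempty k ts
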